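{- Let $A$ be a finite set of alternatives, let $\mathcal{D}\subseteq\mathcal{L}(A)$ be a Condorcet domain, and let $a,b,c\in A$ be distinct. Then $a$ is a right obstruction to the swap $bc\to cb$ in $\mathcal{D}$ if and only if the restriction $\mathcal{D}|_{\{a,b,c\}}$ satisfies $cN_{\{a,b,c\}}1$ or $bN_{\{a,b,c\}}2$ (or both), and satisfies no other never-condition.
   Context: $\mathcal{L}(A)$ is the set of all linear orders on $A$. A linear order is written as a word listing the alternatives from most preferred (position 1, leftmost) to least preferred (last position, rightmost). For $B\subseteq A$ and $\mathcal{D}\subseteq\mathcal{L}(A)$, the restriction $\mathcal{D}|_B$ is the set of linear orders on $B$ obtained by restricting the orders of $\mathcal{D}$ to $B$. For a triple $T=\{x,y,z\}\subseteq A$, $x\in T$ and $i\in\{1,2,3\}$, the never-condition $xN_T i$ states that in every order of $\mathcal{D}|_T$ the alternative $x$ does not occupy position $i$; we say $\mathcal{D}|_T$ satisfies it if this holds. A domain $\mathcal{D}\subseteq\mathcal{L}(A)$ is a Condorcet domain if for every triple $T\subseteq A$ the restriction $\mathcal{D}|_T$ satisfies at least one never-condition (equivalently, the majority relation of every profile of an odd number of orders from $\mathcal{D}$ is transitive). Right obstruction: if $w\in\mathcal{D}$ is an order of the form $w=\ldots bc\ldots a\ldots$ (i.e. $b$ immediately precedes $c$, and $a$ is ranked below $c$), then $a$ is a right obstruction to the swap $bc\to cb$ if the order $cba$ cannot be in $\mathcal{D}|_{\{a,b,c\}}$, i.e. $\mathcal{D}|_{\{a,b,c\}}\cup\{cba\}$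 is not a Condorcet domain on $\{a,b,c\}$. -}

module Defs where

open import Data.Nat using (ℕ; zero; suc; _≤_)
open import Data.Fin using (Fin; _≟_)
open import Data.List using (List; []; _∷_; _++_; filter)
open import Data.List.Relation.Unary.Unique.Propositional using (Unique)
open import Data.List.Membership.Propositional using (_∈_)
open import Data.Product using (Σ; ∃; ∃-syntax; _×_; _,_; proj₁)
open import Data.Sum using (_⊎_)
open import Data.Empty using (⊥)
open import Relation.Nullary using (¬_)
open import Relation.Binary.PropositionalEquality using (_≡_)
import Data.List.Membership.DecPropositional as DecMem

-- The set of alternatives A is Fin n.
-- A linear order on A: a list without repetitions containing every
-- alternative, read from most preferred (head) to least preferred.
record LinearOrder (n : ℕ) : Set where
  constructor mkLO
  field
    order    : List (Fin n)
    unique   : Unique order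
    complete : ∀ (x : Fin n) → x ∈ order
open LinearOrder public

Domain : ℕ → Set₁
Domain n = LinearOrder n → Set

OrderSet : ℕ → Set₁
OrderSet n = List (Fin n) → Set

triple : ∀ {n} → Fin n → Fin n → Fin n → List (Fin n)
triple x y z = x ∷ y ∷ z ∷ []

InTriple : ∀ {n} → Fin n → Fin n → Fin n → Fin n → Set
InTriple x y z t = t ≡ x ⊎ t ≡ y ⊎ t ≡ z

Distinct3 : ∀ {n} → Fin n → Fin n → Fin n → Set
Distinct3 x y z = ¬ x ≡ y × ¬ x ≡ z × ¬ y ≡ z

restrictList : ∀ {n} → Fin n → Fin n → Fin n → List (Fin n) → List (Fin n)
restrictList {n} x y z = filter (λ v → v ∈? triple x y z)
  where open DecMem (_≟_ {n})

Restrict : ∀ {n} → Domain n → Fin n → Fin n → Fin n → OrderSet n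
Restrict D x y z l = ∃[ w ] (D w × restrictList x y z (order w) ≡ l)

-- Position (1-based) of an alternative in an order: OccupiesAt l i t
-- means that t is at position i of l.
OccupiesAt : ∀ {n} → List (Fin n) → ℕ → Fin n → Set
OccupiesAt []      _             t = ⊥
OccupiesAt (v ∷ l) zero          t = ⊥
OccupiesAt (v ∷ l) (suc zero)    t = v ≡ t
OccupiesAt (v ∷ l) (suc (suc i)) t = OccupiesAt l (suc i) t

Never : ∀ {n} → OrderSet n → Fin n → ℕ → Set
Never S t i = ∀ l → S l → ¬ OccupiesAt l i t

CondorcetOnTriple : ∀ {n} → OrderSet n → Fin n → Fin n → Fin n → Set
CondorcetOnTriple S x y z =
  ∃[ t ] ∃[ i ] (InTriple x y z t × 1 ≤ i × i ≤ 3 × Never S t i)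

CondorcetDomain : ∀ {n} → Domain n → Set
CondorcetDomain D =
  ∀ x y z → Distinct3 x y z → CondorcetOnTriple (Restrict D x y z) x y z

HasForm-bc-a : ∀ {n} → LinearOrder n → Fin n → Fin n → Fin n → Set
HasForm-bc-a w a b c =
  ∃[ pre ] ∃[ mid ] ∃[ post ] (order w ≡ pre ++ (b ∷ c ∷ mid ++ (a ∷ post)))

-- a is a right obstruction to the swap bc → cb: D|_{a,b,c} ∪ {cba} is not
-- a Condorcet domain on {a,b,c}.  (Used in the presence of an order
-- w ∈ D of the form ...bc...a..., which is a hypothesis of the theorem.)
RightObstruction : ∀ {n} → Domain n → Fin n → Fin n → Fin n → Set
RightObstruction D a b c =
  ¬ CondorcetOnTriple
      (λ l → Restrict D a b c l ⊎ l ≡ c ∷ b ∷ a ∷ [])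
      a b c

{-# OPTIONS --safe #-}
-- Since w restricts to bca, the orders of D|_{a,b,c} already violate aN3, bN1 and cN2;
-- the new order cba violates exactly cN1, bN2 and aN3. So D|_{a,b,c} ∪ {cba} is
-- Condorcet iff D|_{a,b,c} satisfies a never-condition other than cN1 and bN2, and
-- D|_{a,b,c} itself satisfies at least one never-condition because D is Condorcet.
module Submission where

open import Defs
open import Data.Nat using (ℕ; _≤_; zero; suc)
open import Data.Fin using (Fin; _≟_)
open import Data.List using (List; []; _∷_; _++_)
import Data.List.Relation.Unary.All as All
open import Data.List.Relation.Unary.Any using (here; there)
open import Data.List.Relation.Unary.Unique.Propositional using (Unique; _∷_)
open import Data.List.Relation.Unary.Unique.Propositional.Properties
  using (Unique[x∷xs]⇒x∉xs)
open import Data.List.Relation.Binary.Disjoint.Propositional using (Disjoint)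
open import Data.List.Membership.Propositional using (_∈_)
open import Data.List.Membership.Propositional.Properties using (∈-++⁺ˡ; ∈-++⁺ʳ)
import Data.List.Membership.DecPropositional as DecMem
open import Data.List.Properties using (filter-++; filter-none; filter-accept)
open import Data.Product using (_×_; _,_; proj₂)
open import Data.Sum using (_⊎_; inj₁; inj₂)
open import Function.Base using (_∘_)
open import Function.Bundles using (_⇔_; mk⇔)
import Function.Properties.Equivalence as ⇔
open import Relation.Nullary using (¬_; Dec; yes; no; contradiction)
open import Relation.Binary.PropositionalEquality
  using (_≡_; refl; cong; subst; module ≡-Reasoning)

module _ {A : Set} where

  Unique-++⇒Disjoint : ∀ (xs : List A) {ys} → Unique (xs ++ ys) → Disjoint xs ys
  Unique-++⇒Disjoint (x ∷ xs) (x∉ys ∷ _) (here refl , v∈ys) =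
    All.lookup x∉ys (∈-++⁺ʳ xs v∈ys) refl
  Unique-++⇒Disjoint (x ∷ xs) (_ ∷ u) (there v∈xs , v∈ys) =
    Unique-++⇒Disjoint xs u (v∈xs , v∈ys)

  Unique-++⁻ʳ : ∀ (xs : List A) {ys} → Unique (xs ++ ys) → Unique ys
  Unique-++⁻ʳ []       u       = u
  Unique-++⁻ʳ (x ∷ xs) (_ ∷ u) = Unique-++⁻ʳ xs u

module _ {n : ℕ} where

  module _ (x y z : Fin n) where
    open DecMem (_≟_ {n}) using (_∈?_)

    restrictList-++ : ∀ xs ys →
      restrictList x y z (xs ++ ys) ≡ restrictList x y z xs ++ restrictList x y z ys
    restrictList-++ = filter-++ (_∈? triple x y z)

    restrictList-accept : ∀ {t} xs → t ∈ triple x y z →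
      restrictList x y z (t ∷ xs) ≡ t ∷ restrictList x y z xs
    restrictList-accept xs = filter-accept (_∈? triple x y z)

    restrictList-reject : ∀ {xs} → Disjoint (triple x y z) xs → restrictList x y z xs ≡ []
    restrictList-reject disjoint =
      filter-none (_∈? triple x y z)
        (All.tabulate λ v∈xs v∈xyz → disjoint (v∈xyz , v∈xs))

  Unique-bc-a⇒Disjoint : ∀ {a b c : Fin n} pre mid post →
    Unique (pre ++ b ∷ c ∷ mid ++ a ∷ post) →
    Disjoint (triple a b c) pre × Disjoint (triple a b c) mid × Disjoint (triple a b c) post
  Unique-bc-a⇒Disjoint {a} {b} {c} pre mid post u = pre# , mid# , post#
    where
    u-mid : Unique (mid ++ a ∷ post)
    u-mid = Unique-++⁻ʳ (b ∷ c ∷ []) (Unique-++⁻ʳ pre u)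
    pre#rest : Disjoint pre (b ∷ c ∷ mid ++ a ∷ post)
    pre#rest = Unique-++⇒Disjoint pre u
    bc#rest : Disjoint (b ∷ c ∷ []) (mid ++ a ∷ post)
    bc#rest = Unique-++⇒Disjoint (b ∷ c ∷ []) (Unique-++⁻ʳ pre u)
    pre# : Disjoint (triple a b c) pre
    pre# (here refl , p)                 = pre#rest (p , there (there (∈-++⁺ʳ mid (here refl))))
    pre# (there (here refl) , p)         = pre#rest (p , here refl)
    pre# (there (there (here refl)) , p) = pre#rest (p , there (here refl))
    mid# : Disjoint (triple a b c) mid
    mid# (here refl , p)                 = Unique-++⇒Disjoint mid u-mid (p , here refl)
    mid# (there (here refl) , p)         = bc#rest (here refl , ∈-++⁺ˡ p)
    mid# (there (there (here refl)) , p) = bc#rest (there (here refl) , ∈-++⁺ˡ p)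
    post# : Disjoint (triple a b c) post
    post# (here refl , p)                 = Unique[x∷xs]⇒x∉xs (Unique-++⁻ʳ mid u-mid) p
    post# (there (here refl) , p)         = bc#rest (here refl , ∈-++⁺ʳ mid (there p))
    post# (there (there (here refl)) , p) = bc#rest (there (here refl) , ∈-++⁺ʳ mid (there p))

  restrictList-bc-a : ∀ (a b c : Fin n) (w : LinearOrder n) → HasForm-bc-a w a b c →
    restrictList a b c (order w) ≡ b ∷ c ∷ a ∷ []
  restrictList-bc-a a b c w (pre , mid , post , w≡)
    with pre# , mid# , post# ← Unique-bc-a⇒Disjoint pre mid post (subst Unique w≡ (unique w))
    = begin
    restrictList a b c (order w)
      ≡⟨ cong (restrictList a b c) w≡ ⟩
    restrictList a b c (pre ++ b ∷ c ∷ mid ++ a ∷ post)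
      ≡⟨ restrictList-++ a b c pre _ ⟩
    restrictList a b c pre ++ restrictList a b c (b ∷ c ∷ mid ++ a ∷ post)
      ≡⟨ cong (_++ _) (restrictList-reject a b c pre#) ⟩
    restrictList a b c (b ∷ c ∷ mid ++ a ∷ post)
      ≡⟨ restrictList-accept a b c _ (there (here refl)) ⟩
    b ∷ restrictList a b c (c ∷ mid ++ a ∷ post)
      ≡⟨ cong (b ∷_) (restrictList-accept a b c _ (there (there (here refl)))) ⟩
    b ∷ c ∷ restrictList a b c (mid ++ a ∷ post)
      ≡⟨ cong (λ l → b ∷ c ∷ l) (restrictList-++ a b c mid _) ⟩
    b ∷ c ∷ restrictList a b c mid ++ restrictList a b c (a ∷ post)
      ≡⟨ cong (λ l → b ∷ c ∷ l ++ _) (restrictList-reject a b c mid#) ⟩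
    b ∷ c ∷ restrictList a b c (a ∷ post)
      ≡⟨ cong (λ l → b ∷ c ∷ l) (restrictList-accept a b c post (here refl)) ⟩
    b ∷ c ∷ a ∷ restrictList a b c post
      ≡⟨ cong (λ l → b ∷ c ∷ a ∷ l) (restrictList-reject a b c post#) ⟩
    b ∷ c ∷ a ∷ [] ∎
    where open ≡-Reasoning

  occupiesAt? : ∀ (l : List (Fin n)) i t → Dec (OccupiesAt l i t)
  occupiesAt? []      _             _ = no λ ()
  occupiesAt? (v ∷ l) zero          _ = no λ ()
  occupiesAt? (v ∷ l) (suc zero)    t = v ≟ t
  occupiesAt? (v ∷ l) (suc (suc i)) t = occupiesAt? l (suc i) t

  occupiesAt-triple : ∀ {x y z t : Fin n} {i} → OccupiesAt (triple x y z) i t →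
    (t ≡ x × i ≡ 1) ⊎ (t ≡ y × i ≡ 2) ⊎ (t ≡ z × i ≡ 3)
  occupiesAt-triple {i = 1} refl = inj₁ (refl , refl)
  occupiesAt-triple {i = 2} refl = inj₂ (inj₁ (refl , refl))
  occupiesAt-triple {i = 3} refl = inj₂ (inj₂ (refl , refl))

  Extend : OrderSet n → List (Fin n) → OrderSet n
  Extend S l m = S m ⊎ m ≡ l

  NeverOnlyAt : OrderSet n → Fin n → Fin n → Fin n → (Fin n → ℕ → Set) → Set
  NeverOnlyAt S x y z P =
    ∀ t i → InTriple x y z t → 1 ≤ i → i ≤ 3 → Never S t i → P t i

  OccupiedIn : List (Fin n) → Fin n → ℕ → Set
  OccupiedIn l t i = OccupiesAt l i t

  FirstOrSecond : Fin n → Fin n → Fin n → ℕ → Set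
  FirstOrSecond u v t i = (t ≡ u × i ≡ 1) ⊎ (t ≡ v × i ≡ 2)

  ¬CondorcetOnTriple-Extend⇔ : ∀ (S : OrderSet n) l x y z →
    (¬ CondorcetOnTriple (Extend S l) x y z) ⇔ NeverOnlyAt S x y z (OccupiedIn l)
  ¬CondorcetOnTriple-Extend⇔ S l x y z = mk⇔ occupied extendable
    where
    occupied : ¬ CondorcetOnTriple (Extend S l) x y z →
               NeverOnlyAt S x y z (OccupiedIn l)
    occupied ¬cond t i t∈ 1≤i i≤3 never with occupiesAt? l i t
    ... | yes occ = occ
    ... | no ¬occ = contradiction (t , i , t∈ , 1≤i , i≤3 , never′) ¬cond
      where
      never′ : Never (Extend S l) t i
      never′ m (inj₁ Sm)   = never m Sm
      never′ m (inj₂ refl) = ¬occ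
    extendable : NeverOnlyAt S x y z (OccupiedIn l) →
                 ¬ CondorcetOnTriple (Extend S l) x y z
    extendable only (t , i , t∈ , 1≤i , i≤3 , never) =
      never l (inj₂ refl) (only t i t∈ 1≤i i≤3 (λ m → never m ∘ inj₁))

  NeverOnlyAt-cba⇔ : ∀ (S : OrderSet n) a b c → S (b ∷ c ∷ a ∷ []) →
    NeverOnlyAt S a b c (OccupiedIn (c ∷ b ∷ a ∷ [])) ⇔
      NeverOnlyAt S a b c (FirstOrSecond c b)
  NeverOnlyAt-cba⇔ S a b c bca∈S = mk⇔ forward backward
    where
    forward : NeverOnlyAt S a b c (OccupiedIn (c ∷ b ∷ a ∷ [])) →
              NeverOnlyAt S a b c (FirstOrSecond c b)
    forward only t i t∈ 1≤i i≤3 never with occupiesAt-triple (only t i t∈ 1≤i i≤3 never)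
    ... | inj₁ c1                   = inj₁ c1
    ... | inj₂ (inj₁ b2)            = inj₂ b2
    ... | inj₂ (inj₂ (refl , refl)) = contradiction refl (never _ bca∈S)
    backward : NeverOnlyAt S a b c (FirstOrSecond c b) →
               NeverOnlyAt S a b c (OccupiedIn (c ∷ b ∷ a ∷ []))
    backward only t i t∈ 1≤i i≤3 never with only t i t∈ 1≤i i≤3 never
    ... | inj₁ (refl , refl) = refl
    ... | inj₂ (refl , refl) = refl

  NeverOnlyAt-FirstOrSecond⇔ : ∀ {S : OrderSet n} {x y z u v} → CondorcetOnTriple S x y z →
    NeverOnlyAt S x y z (FirstOrSecond u v) ⇔
      ((Never S u 1 ⊎ Never S v 2) × NeverOnlyAt S x y z (FirstOrSecond u v))
  NeverOnlyAt-FirstOrSecond⇔ {S} {x} {y} {z} {u} {v} (t , i , t∈ , 1≤i , i≤3 , never) =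
    mk⇔ (λ only → witness only , only) proj₂
    where
    witness : NeverOnlyAt S x y z (FirstOrSecond u v) → Never S u 1 ⊎ Never S v 2
    witness only with only t i t∈ 1≤i i≤3 never
    ... | inj₁ (refl , refl) = inj₁ never
    ... | inj₂ (refl , refl) = inj₂ never

mainTheorem1 : ∀ (n : ℕ) (D : Domain n) → CondorcetDomain D →
    ∀ (a b c : Fin n) → Distinct3 a b c →
    ∀ (w : LinearOrder n) → D w → HasForm-bc-a w a b c →
    (RightObstruction D a b c ⇔
      ((Never (Restrict D a b c) c 1 ⊎ Never (Restrict D a b c) b 2)
       × (∀ (t : Fin n) (i : ℕ) → InTriple a b c t → 1 ≤ i → i ≤ 3 →
            Never (Restrict D a b c) t i →
            (t ≡ c × i ≡ 1) ⊎ (t ≡ b × i ≡ 2))))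
mainTheorem1 n D condorcet a b c distinct w w∈D form =
  ⇔.trans (¬CondorcetOnTriple-Extend⇔ S (c ∷ b ∷ a ∷ []) a b c)
    (⇔.trans (NeverOnlyAt-cba⇔ S a b c bca∈S)
      (NeverOnlyAt-FirstOrSecond⇔ (condorcet a b c distinct)))
  where
  S : OrderSet n
  S = Restrict D a b c
  bca∈S : S (b ∷ c ∷ a ∷ [])
  bca∈S = w , w∈D , restrictList-bc-a a b c w form
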